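{- Let $(T,S)\in\mathscr{T}$. Then: (i) $S_B$ is an independent dominating set of $T$, and for every $v\in S_B$, $|N(v)\cap S_A|=2$ and $pn[v,S_B]=(N(v)\cap S_A)\cup\{v\}$; (ii) every vertex of $S_A$ is adjacent to exactly one vertex of $S_B$, and $|S_A|=2|S_B|$; (iii) every vertex of $S_C$ is adjacent to at least $2$ vertices of $S_B$; (iv) $S_B$ is the unique $\gamma$-set of $T$.
   Context: A labeling of a tree $T$ is a function $S:V(T)\to\{A,B,C\}$; $S_A,S_B,S_C$ denote the sets of vertices with label (status) $A$, $B$, $C$. A labeled $K_{1,2}$ is a path on 3 vertices whose two leaves have status $A$ and whose center has status $B$. $\mathscr{T}$ is the family of labeled trees $(T,S)$ obtainable from a sequence $(T_1,S_1),\dots,(T_j,S_j)$, $j\ge1$, where $(T_1,S_1)$ is a labeled $K_{1,2}$, $(T,S)=(T_j,S_j)$, and each $(T_{i+1},S_{i+1})$ is obtained from $(T_i,S_i)$ (keeping all old statuses) by one of: O1: add a path $x,y,z$ and an edge $ux$ with $u\in V(T_i)$ of status $A$ or $C$, with statuses $x,z\mapsto A$, $y\mapsto B$. O2: add a star with center $y$ and leaves $x,z,t$ and an edge $ux$ with $u\in V(T_i)$ of status $B$, with statuses $x\mapsto C$, $z,t\mapsto A$, $y\mapsto B$. O3: add a path $x,y,z$ and an edge $uy$ with $u\in V(T_i)$ of status $C$, with statuses $x,z\mapsto A$, $y\mapsto B$. O4: add a disjoint copy of the labeled tree $R$ (the labeled tree obtained from a labeled $K_{1,2}$ by one application of O2;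 it has 7 vertices and exactly one vertex of status $C$) and an edge $ux$ where $u\in V(T_i)$ has status $A$ or $C$ and $x$ is the vertex of status $C$ in $R$. $N(v)$ is the open neighborhood; for $x\in X\subseteq V(T)$, $pn[x,X]=\{y: N[y]\cap X=\{x\}\}$. A $\gamma$-set is a minimum-size dominating set. -}

module Defs where

open import Data.Nat using (ℕ; suc; zero; _+_; _*_; _≤_)
open import Data.Bool using (Bool; true; false; _∧_; _∨_)
open import Data.Fin using (Fin; zero; suc; _↑ˡ_; _↑ʳ_; splitAt; _≟_)
open import Data.Fin.Subset using (Subset; _∈_; ∣_∣; _∩_; _∪_; ⁅_⁆)
open import Data.Vec using (Vec; tabulate)
open import Data.Vec.Properties using (≡-dec)
open import Data.List using (List; []; _∷_; _++_; map)
open import Data.Bool.ListAction using (any)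
open import Data.Product using (_×_; _,_; proj₁; proj₂; Σ; ∃)
open import Data.Sum using (_⊎_; inj₁; inj₂; [_,_])
open import Relation.Nullary using (¬_)
open import Relation.Nullary.Decidable using (⌊_⌋)
open import Relation.Binary.PropositionalEquality using (_≡_)
import Data.Bool.Properties as BoolP

data Status : Set where
  A B C : Status

_=S_ : Status → Status → Bool
A =S A = true
B =S B = true
C =S C = true
_ =S _ = false

record LGraph : Set where
  constructor mkLG
  field
    size  : ℕ
    edges : List (Fin size × Fin size)
    lab   : Fin size → Status
open LGraph public

adjB : (G : LGraph) → Fin (size G) → Fin (size G) → Bool
adjB G u v = any (λ e → (⌊ proj₁ e ≟ u ⌋ ∧ ⌊ proj₂ e ≟ v ⌋) ∨ (⌊ proj₁ e ≟ v ⌋ ∧ ⌊ proj₂ e ≟ u ⌋)) (edges G)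

N : (G : LGraph) → Fin (size G) → Subset (size G)
N G v = tabulate (λ w → adjB G v w)

N[_] : (G : LGraph) → Fin (size G) → Subset (size G)
N[ G ] v = N G v ∪ ⁅ v ⁆

statusSet : (G : LGraph) → Status → Subset (size G)
statusSet G s = tabulate (λ v → lab G v =S s)

pn : (G : LGraph) → Fin (size G) → Subset (size G) → Subset (size G)
pn G x X = tabulate (λ y → ⌊ ≡-dec BoolP._≟_ (N[ G ] y ∩ X) ⁅ x ⁆ ⌋)

Dominating : (G : LGraph) → Subset (size G) → Set
Dominating G D = ∀ v → v ∈ D ⊎ Σ (Fin (size G)) (λ u → u ∈ D × v ∈ N G u)

Independent : (G : LGraph) → Subset (size G) → Set
Independent G D = ∀ u v → u ∈ D → v ∈ D → ¬ (v ∈ N G u)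

IsGammaSet : (G : LGraph) → Subset (size G) → Set
IsGammaSet G D = Dominating G D × (∀ D′ → Dominating G D′ → ∣ D ∣ ≤ ∣ D′ ∣)

UniqueGammaSet : (G : LGraph) → Subset (size G) → Set
UniqueGammaSet G D = IsGammaSet G D × (∀ D′ → IsGammaSet G D′ → D′ ≡ D)

glue : (G H : LGraph) → Fin (size G) → Fin (size H) → LGraph
glue G H u x = mkLG (size G + size H)
  ( map (λ e → (proj₁ e ↑ˡ size H) , (proj₂ e ↑ˡ size H)) (edges G)
 ++ map (λ e → (size G ↑ʳ proj₁ e) , (size G ↑ʳ proj₂ e)) (edges H)
 ++ ((u ↑ˡ size H) , (size G ↑ʳ x)) ∷ [] )
  (λ k → [ lab G , lab H ] (splitAt (size G) k))

-- Labeled path x,y,z with statuses A,B,A  (x = 0, y = 1, z = 2).  This is also the labeled K_{1,2}.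
P3 : LGraph
P3 = mkLG 3 ((zero , suc zero) ∷ (suc zero , suc (suc zero)) ∷ [])
  (λ { zero → A ; (suc zero) → B ; (suc (suc zero)) → A })

K12 : LGraph
K12 = P3

-- Labeled star: center y = 1, leaves x = 0 (C), z = 2, t = 3 (A), y of status B
Star : LGraph
Star = mkLG 4 ((suc zero , zero) ∷ (suc zero , suc (suc zero)) ∷ (suc zero , suc (suc (suc zero))) ∷ [])
  (λ { zero → C ; (suc zero) → B ; (suc (suc zero)) → A ; (suc (suc (suc zero))) → A })

-- R = K_{1,2} followed by one application of O2 (at the centre of K_{1,2}, the only B vertex)
R : LGraph
R = glue K12 Star (suc zero) zero

-- the unique vertex of status C in R (the x of the attached star)
Rc : Fin (size R)
Rc = 3 ↑ʳ zero

data InFamily : LGraph → Set where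
  base : InFamily K12
  O1 : ∀ {G} → InFamily G → (u : Fin (size G)) → (lab G u ≡ A ⊎ lab G u ≡ C)
     → InFamily (glue G P3 u zero)
  O2 : ∀ {G} → InFamily G → (u : Fin (size G)) → lab G u ≡ B
     → InFamily (glue G Star u zero)
  O3 : ∀ {G} → InFamily G → (u : Fin (size G)) → lab G u ≡ C
     → InFamily (glue G P3 u (suc zero))
  O4 : ∀ {G} → InFamily G → (u : Fin (size G)) → (lab G u ≡ A ⊎ lab G u ≡ C)
     → InFamily (glue G R u Rc)

module Submission where

-- Every claim is an invariant of the four operations, proved by induction on the construction.
-- Each operation attaches a small labelled tree H to G by one edge ux that never joins a B vertex
-- to an A or B vertex, so the local counts of (i)-(iii) and |S_A| = 2|S_B| simply add up.
-- For (iv) we carry a stronger invariant: S_B is the unique smallest set dominating all vertices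
-- of status A or B.  A set d dominating T restricts to such sets on G and on H, unless the edge ux
-- is used; then d contains an endpoint that is not of status B, so that side is strictly larger
-- than its S_B, while the other side becomes dominating after adding one vertex.  In O2, where u
-- has status B, the G side cannot do with S_B minus u, since u is the only B-neighbour of its
-- A-neighbours; in O3 a set avoiding the centre of the new path must contain both its leaves.

open import Defs
open import Data.Nat using (ℕ; zero; suc; _+_; _*_; _≤_; _<_; z≤n; s≤s)
open import Data.Nat.Properties
  using (≤-refl; ≤-trans; ≤-reflexive; ≤-pred; <⇒≤; <-irrefl; <-≤-trans; m≤m+n; m≤n+m; +-mono-≤; +-mono-<-≤; +-mono-≤-<; +-assoc; +-comm; +-commutativeSemigroup; *-distribˡ-+)
open import Algebra.Properties.CommutativeSemigroup +-commutativeSemigroup using (interchange)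
open import Data.Bool using (Bool; true; false; _∧_; _∨_)
open import Data.Bool.Properties using (∨-identityʳ; ∨-zeroʳ; ∨-comm; ∨-assoc; ∧-zeroʳ; ∧-identityʳ; ∧-comm; ∧-conicalˡ; ∧-conicalʳ)
import Data.Bool.Properties as 𝔹
open import Data.Fin using (Fin; zero; suc; _↑ˡ_; _↑ʳ_; _≟_)
open import Data.Fin.Properties using (suc-injective; ↑ˡ-injective; ↑ʳ-injective; splitAt-↑ˡ; splitAt-↑ʳ)
open import Data.List using ([]; _∷_; _++_; map)
open import Data.List.Properties using (map-∘; map-cong)
open import Data.Bool.ListAction using (any; or)
open import Data.Fin.Subset using (Subset; _∈_; ∣_∣; _∩_; _∪_; ⁅_⁆)
open import Data.Vec using (tabulate; lookup)
open import Data.Vec.Properties using (lookup∘tabulate; tabulate∘lookup; tabulate-cong; []=⇒lookup; lookup⇒[]=; lookup-zipWith; lookup-replicate; ≡-dec)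
open import Data.Product using (_×_; _,_; proj₁; proj₂; Σ; ∃)
open import Data.Sum using (_⊎_; inj₁; inj₂)
open import Data.Empty using (⊥-elim)
open import Function using (_∘_)
open import Relation.Nullary using (¬_; yes; no)
open import Relation.Nullary.Decidable using (⌊_⌋; ⌊⌋-map′; isYes≗does; dec-true; dec-false)
open import Relation.Binary.PropositionalEquality

indicator : Bool → ℕ
indicator true  = 1
indicator false = 0

bool-clash : ∀ {b} {P : Set} → b ≡ true → b ≡ false → P
bool-clash refl ()

count : ∀ {n} → (Fin n → Bool) → ℕ
count {zero}  f = 0
count {suc n} f = indicator (f zero) + count (f ∘ suc)

count-cong : ∀ {n} {f g : Fin n → Bool} → f ≗ g → count f ≡ count g
count-cong {zero}  f≗g = refl
count-cong {suc n} f≗g = cong₂ _+_ (cong indicator (f≗g zero)) (count-cong (f≗g ∘ suc))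

count-↑ : ∀ n {m} (f : Fin (n + m) → Bool) → count f ≡ count (f ∘ (_↑ˡ m)) + count (f ∘ (n ↑ʳ_))
count-↑ zero    f = refl
count-↑ (suc n) f =
  trans (cong (indicator (f zero) +_) (count-↑ n (f ∘ suc))) (sym (+-assoc (indicator (f zero)) _ _))

count-none : ∀ {n} (f : Fin n → Bool) → (∀ i → f i ≡ false) → count f ≡ 0
count-none {zero}  f none = refl
count-none {suc n} f none rewrite none zero = count-none (f ∘ suc) (none ∘ suc)

count-witness : ∀ {n} (f : Fin n → Bool) → 1 ≤ count f → ∃ λ i → f i ≡ true
count-witness {suc n} f 1≤ with f zero in f0
... | true  = zero , f0
... | false = let i , fi = count-witness (f ∘ suc) 1≤ in suc i , fi

count-≥1 : ∀ {n} (f : Fin n → Bool) i → f i ≡ true → 1 ≤ count f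
count-≥1 f zero    fi rewrite fi = s≤s z≤n
count-≥1 f (suc i) fi = ≤-trans (count-≥1 (f ∘ suc) i fi) (m≤n+m _ (indicator (f zero)))

count-≥2 : ∀ {n} (f : Fin n → Bool) i j → i ≢ j → f i ≡ true → f j ≡ true → 2 ≤ count f
count-≥2 f zero    zero    i≢j _  _  = ⊥-elim (i≢j refl)
count-≥2 f zero    (suc j) _   fi fj rewrite fi = s≤s (count-≥1 (f ∘ suc) j fj)
count-≥2 f (suc i) zero    _   fi fj rewrite fj = s≤s (count-≥1 (f ∘ suc) i fi)
count-≥2 f (suc i) (suc j) i≢j fi fj =
  ≤-trans (count-≥2 (f ∘ suc) i j (i≢j ∘ cong suc) fi fj) (m≤n+m _ (indicator (f zero)))

count-mono : ∀ {n} (f g : Fin n → Bool) → (∀ i → f i ≡ true → g i ≡ true) → count f ≤ count g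
count-mono {zero}  f g f⊆g = z≤n
count-mono {suc n} f g f⊆g =
  +-mono-≤ (indicator-mono (f zero) (g zero) (f⊆g zero)) (count-mono (f ∘ suc) (g ∘ suc) (f⊆g ∘ suc))
  where
  indicator-mono : ∀ a b → (a ≡ true → b ≡ true) → indicator a ≤ indicator b
  indicator-mono false b     _   = z≤n
  indicator-mono true  true  _   = ≤-refl
  indicator-mono true  false a⇒b with () ← a⇒b refl

count-∨ : ∀ {n} (f g : Fin n → Bool) → count (λ i → f i ∨ g i) ≤ count f + count g
count-∨ {zero}  f g = z≤n
count-∨ {suc n} f g =
  ≤-trans (+-mono-≤ (indicator-∨ (f zero) (g zero)) (count-∨ (f ∘ suc) (g ∘ suc)))
          (≤-reflexive (interchange (indicator (f zero)) (indicator (g zero)) (count (f ∘ suc)) (count (g ∘ suc))))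
  where
  indicator-∨ : ∀ a b → indicator (a ∨ b) ≤ indicator a + indicator b
  indicator-∨ false b = ≤-refl
  indicator-∨ true  b = s≤s z≤n

≢-by : ∀ {X : Set} (f : X → Bool) {a b} → f a ≡ true → f b ≡ false → a ≢ b
≢-by f fa fb refl = bool-clash fa fb

≟-refl : ∀ {n} (a : Fin n) → ⌊ a ≟ a ⌋ ≡ true
≟-refl a = trans (isYes≗does (a ≟ a)) (dec-true (a ≟ a) refl)

≟-≢ : ∀ {n} {a b : Fin n} → a ≢ b → ⌊ a ≟ b ⌋ ≡ false
≟-≢ {a = a} {b} a≢b = trans (isYes≗does (a ≟ b)) (dec-false (a ≟ b) a≢b)

≟-true⇒≡ : ∀ {n} {a b : Fin n} → ⌊ a ≟ b ⌋ ≡ true → a ≡ b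
≟-true⇒≡ {a = a} {b} a≟b with a ≟ b
... | yes a≡b = a≡b

≡-or-≢ : ∀ {n} (a b : Fin n) → a ≡ b ⊎ a ≢ b
≡-or-≢ a b with a ≟ b
... | yes a≡b = inj₁ a≡b
... | no  a≢b = inj₂ a≢b

≟-injective : ∀ {n k} (e : Fin n → Fin k) → (∀ {a b} → e a ≡ e b → a ≡ b) → ∀ a b → ⌊ e a ≟ e b ⌋ ≡ ⌊ a ≟ b ⌋
≟-injective e inj a b with a ≟ b
... | yes refl = ≟-refl (e a)
... | no  a≢b  = ≟-≢ (a≢b ∘ inj)

count-singleton : ∀ {n} (x : Fin n) → count (λ j → ⌊ x ≟ j ⌋) ≡ 1
count-singleton {suc n} zero    = cong suc (count-none {n} _ (λ _ → refl))
count-singleton {suc n} (suc x) =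
  trans (count-cong (λ j → ⌊⌋-map′ (cong suc) suc-injective (x ≟ j))) (count-singleton x)

count-at : ∀ {n} (x : Fin n) (f : Fin n → Bool) → count (λ j → ⌊ x ≟ j ⌋ ∧ f j) ≡ indicator (f x)
count-at x f = trans (count-cong only-x-matters) (count-at-const (f x))
  where
  only-x-matters : ∀ j → ⌊ x ≟ j ⌋ ∧ f j ≡ ⌊ x ≟ j ⌋ ∧ f x
  only-x-matters j with x ≟ j
  ... | yes refl = refl
  ... | no  _    = refl

  count-at-const : ∀ b → count (λ j → ⌊ x ≟ j ⌋ ∧ b) ≡ indicator b
  count-at-const false = count-none _ (λ j → ∧-zeroʳ ⌊ x ≟ j ⌋)
  count-at-const true  = trans (count-cong (λ j → ∧-identityʳ ⌊ x ≟ j ⌋)) (count-singleton x)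

count-guarded : ∀ {n} c (x : Fin n) (f : Fin n → Bool) → count (λ j → (c ∧ ⌊ x ≟ j ⌋) ∧ f j) ≡ indicator (c ∧ f x)
count-guarded false x f = count-none (λ j → (false ∧ ⌊ x ≟ j ⌋) ∧ f j) (λ _ → refl)
count-guarded true  x f = count-at x f

insert : ∀ {n} → Fin n → (Fin n → Bool) → Fin n → Bool
insert p d i = d i ∨ ⌊ p ≟ i ⌋

insert-⊇ : ∀ {n} (p : Fin n) d i → d i ≡ true → insert p d i ≡ true
insert-⊇ p d i di rewrite di = refl

insert-new : ∀ {n} (p : Fin n) d → insert p d p ≡ true
insert-new p d = trans (cong (d p ∨_) (≟-refl p)) (∨-zeroʳ (d p))

count-insert : ∀ {n} (p : Fin n) d → count (insert p d) ≤ suc (count d)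
count-insert p d = ≤-trans (count-∨ d _) (≤-reflexive (trans (cong (count d +_) (count-singleton p)) (+-comm (count d) 1)))

data SumView (n m : ℕ) : Fin (n + m) → Set where
  left  : (i : Fin n) → SumView n m (i ↑ˡ m)
  right : (j : Fin m) → SumView n m (n ↑ʳ j)

sumView : ∀ n m (k : Fin (n + m)) → SumView n m k
sumView zero    m k       = right k
sumView (suc n) m zero    = left zero
sumView (suc n) m (suc k) with sumView n m k
... | left i  = left (suc i)
... | right j = right j

↑ˡ≢↑ʳ : ∀ {n m} (i : Fin n) (j : Fin m) → i ↑ˡ m ≢ n ↑ʳ j
↑ˡ≢↑ʳ (suc i) j eq = ↑ˡ≢↑ʳ i j (suc-injective eq)

any-++ : ∀ {X : Set} (f : X → Bool) xs ys → any f (xs ++ ys) ≡ any f xs ∨ any f ys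
any-++ f []       ys = refl
any-++ f (x ∷ xs) ys = trans (cong (f x ∨_) (any-++ f xs ys)) (sym (∨-assoc (f x) _ _))

any-map : ∀ {X Y : Set} (f : Y → Bool) (g : X → Y) xs → any f (map g xs) ≡ any (f ∘ g) xs
any-map f g xs = cong or (sym (map-∘ xs))

any-cong : ∀ {X : Set} {f g : X → Bool} → f ≗ g → ∀ xs → any f xs ≡ any g xs
any-cong f≗g xs = cong or (map-cong f≗g xs)

any-false : ∀ {X : Set} (f : X → Bool) → (∀ e → f e ≡ false) → ∀ xs → any f xs ≡ false
any-false f none xs = trans (any-cong none xs) (any-const-false xs)
  where
  any-const-false : ∀ xs → any (λ _ → false) xs ≡ false
  any-const-false []       = refl
  any-const-false (_ ∷ xs) = any-const-false xs

edgeAt : ∀ {k} → Fin k → Fin k → Fin k × Fin k → Bool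
edgeAt a b e = (⌊ proj₁ e ≟ a ⌋ ∧ ⌊ proj₂ e ≟ b ⌋) ∨ (⌊ proj₁ e ≟ b ⌋ ∧ ⌊ proj₂ e ≟ a ⌋)

module _ {k : ℕ} {a b p q : Fin k} where

  edgeAt-avoidsˡ : p ≢ a → q ≢ a → edgeAt a b (p , q) ≡ false
  edgeAt-avoidsˡ p≢a q≢a rewrite ≟-≢ p≢a | ≟-≢ q≢a = ∧-zeroʳ _

  edgeAt-avoidsʳ : p ≢ b → q ≢ b → edgeAt a b (p , q) ≡ false
  edgeAt-avoidsʳ p≢b q≢b rewrite ≟-≢ p≢b | ≟-≢ q≢b = trans (∨-identityʳ _) (∧-zeroʳ _)

  edgeAt-fst∉ : p ≢ a → p ≢ b → edgeAt a b (p , q) ≡ false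
  edgeAt-fst∉ p≢a p≢b rewrite ≟-≢ p≢a | ≟-≢ p≢b = refl

  edgeAt-snd∉ : q ≢ a → q ≢ b → edgeAt a b (p , q) ≡ false
  edgeAt-snd∉ q≢a q≢b rewrite ≟-≢ q≢a | ≟-≢ q≢b = cong₂ _∨_ (∧-zeroʳ ⌊ p ≟ a ⌋) (∧-zeroʳ ⌊ p ≟ b ⌋)

adjB-sym : ∀ G a b → adjB G a b ≡ adjB G b a
adjB-sym G a b = any-cong (λ e → ∨-comm (⌊ proj₁ e ≟ a ⌋ ∧ ⌊ proj₂ e ≟ b ⌋) _) (edges G)

A≢C : A ≢ C
A≢C ()

A≢B : A ≢ B
A≢B ()

C≢B : C ≢ B
C≢B ()

A-or-C⇒≢B : ∀ {s} → s ≡ A ⊎ s ≡ C → s ≢ B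
A-or-C⇒≢B (inj₁ refl) ()
A-or-C⇒≢B (inj₂ refl) ()

=S⇒≡ : ∀ {s t} → (s =S t) ≡ true → s ≡ t
=S⇒≡ {A} {A} _ = refl
=S⇒≡ {B} {B} _ = refl
=S⇒≡ {C} {C} _ = refl

≡⇒=S : ∀ {s t} → s ≡ t → (s =S t) ≡ true
≡⇒=S {A} refl = refl
≡⇒=S {B} refl = refl
≡⇒=S {C} refl = refl

≢⇒=S-false : ∀ {s t} → s ≢ t → (s =S t) ≡ false
≢⇒=S-false {s} {t} s≢t with s =S t in s=t
... | true  = ⊥-elim (s≢t (=S⇒≡ s=t))
... | false = refl

hasStatus : (G : LGraph) → Status → Fin (size G) → Bool
hasStatus G s v = lab G v =S s

nbrCount : (G : LGraph) → Fin (size G) → Status → ℕ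
nbrCount G v s = count (λ w → adjB G v w ∧ hasStatus G s w)

record Profile (G : LGraph) : Set where
  field
    B-independent : ∀ i j → lab G i ≡ B → lab G j ≡ B → adjB G i j ≡ false
    B-has-two-A   : ∀ v → lab G v ≡ B → nbrCount G v A ≡ 2
    A-has-one-B   : ∀ v → lab G v ≡ A → nbrCount G v B ≡ 1
    A-twice-B     : count (hasStatus G A) ≡ 2 * count (hasStatus G B)

EachCHasTwoB : LGraph → Set
EachCHasTwoB G = ∀ v → lab G v ≡ C → 2 ≤ nbrCount G v B

-- The status pairs that an added edge must not join, lest it break a count of Profile.
data Clash : Status → Status → Set where
  B-B : Clash B B
  B-A : Clash B A
  A-B : Clash A B

clash-sym : ∀ {s t} → Clash s t → Clash t s
clash-sym B-B = B-B
clash-sym B-A = A-B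
clash-sym A-B = B-A

clash-free : ∀ {s t c} → ¬ Clash s t → Clash s c → (t =S c) ≡ false
clash-free {t = t} {c} s≁t s~c with t =S c in t=c
... | true  = ⊥-elim (s≁t (subst (Clash _) (sym (=S⇒≡ t=c)) s~c))
... | false = refl

Dominated : (G : LGraph) → (Fin (size G) → Bool) → Fin (size G) → Set
Dominated G d v = d v ≡ true ⊎ ∃ λ w → d w ≡ true × adjB G w v ≡ true

DominatesNonC : (G : LGraph) → (Fin (size G) → Bool) → Set
DominatesNonC G d = ∀ v → lab G v ≢ C → Dominated G d v

UniqueMinimum : LGraph → Set
UniqueMinimum G = ∀ d → DominatesNonC G d → count (hasStatus G B) < count d ⊎ d ≗ hasStatus G B

dominated-mono : ∀ G {d e v} → (∀ i → d i ≡ true → e i ≡ true) → Dominated G d v → Dominated G e v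
dominated-mono G d⊆e (inj₁ dv)             = inj₁ (d⊆e _ dv)
dominated-mono G d⊆e (inj₂ (w , dw , w~v)) = inj₂ (w , d⊆e w dw , w~v)

module _ {G : LGraph} (unique : UniqueMinimum G) where

  unique-minimum-≤ : ∀ d → DominatesNonC G d → count (hasStatus G B) ≤ count d
  unique-minimum-≤ d dom with unique d dom
  ... | inj₁ B<d = <⇒≤ B<d
  ... | inj₂ d≗B = ≤-reflexive (count-cong (sym ∘ d≗B))

  unique-minimum-< : ∀ {p} d → lab G p ≢ B → d p ≡ true → DominatesNonC G d → count (hasStatus G B) < count d
  unique-minimum-< {p} d p≢B dp dom with unique d dom
  ... | inj₁ B<d = B<d
  ... | inj₂ d≗B with () ← trans (sym dp) (trans (d≗B p) (≢⇒=S-false p≢B))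

  unique-minimum-insert : ∀ {p} d → lab G p ≢ B → DominatesNonC G (insert p d) → count (hasStatus G B) ≤ count d
  unique-minimum-insert {p} d p≢B dom =
    ≤-pred (≤-trans (unique-minimum-< (insert p d) p≢B (insert-new p d) dom) (count-insert p d))

module _ {G : LGraph} (P : Profile G) where
  open Profile P

  A-neighbour : ∀ {u} → lab G u ≡ B → ∃ λ a → adjB G u a ≡ true × lab G a ≡ A
  A-neighbour {u} uB with count-witness (λ w → adjB G u w ∧ hasStatus G A w) (subst (1 ≤_) (sym (B-has-two-A u uB)) (s≤s z≤n))
  ... | a , u~a∧aA = a , ∧-conicalˡ _ _ u~a∧aA , =S⇒≡ (∧-conicalʳ _ _ u~a∧aA)

  B-no-B-neighbour : ∀ {y} w → lab G y ≡ B → adjB G y w ∧ hasStatus G B w ≡ false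
  B-no-B-neighbour {y} w yB with lab G w in lw
  ... | A = ∧-zeroʳ _
  ... | B rewrite B-independent y w yB lw = refl
  ... | C = ∧-zeroʳ _

  A-one-B-neighbour : ∀ {y u} w → lab G y ≡ A → adjB G y u ≡ true → lab G u ≡ B → w ≢ u
    → adjB G y w ∧ hasStatus G B w ≡ false
  A-one-B-neighbour {y} {u} w yA y~u uB w≢u with adjB G y w ∧ hasStatus G B w in y~w
  ... | false = refl
  ... | true with s≤s () ← ≤-trans (count-≥2 (λ z → adjB G y z ∧ hasStatus G B z) w u w≢u y~w (cong₂ _∧_ y~u (≡⇒=S uB)))
                                  (≤-reflexive (A-has-one-B y yA))

  A-neighbour-needs-B : ∀ {u a} → lab G u ≡ B → adjB G u a ≡ true → lab G a ≡ A
    → (e : Fin (size G) → Bool) → e u ≡ false → (∀ i → e i ≡ true → lab G i ≡ B) → ¬ Dominated G e a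
  A-neighbour-needs-B {u} {a} lu u~a la e eu e⊆B (inj₁ ea) with () ← trans (sym la) (e⊆B a ea)
  A-neighbour-needs-B {u} {a} lu u~a la e eu e⊆B (inj₂ (w , ew , w~a)) =
    bool-clash (cong₂ _∧_ (trans (adjB-sym G a w) w~a) (≡⇒=S (e⊆B w ew)))
               (A-one-B-neighbour w la (trans (adjB-sym G a u) u~a) lu (≢-by e ew eu))

module Glued (G H : LGraph) (u : Fin (size G)) (x : Fin (size H)) where

  n m : ℕ
  n = size G
  m = size H

  T : LGraph
  T = glue G H u x

  lab-↑ˡ : ∀ i → lab T (i ↑ˡ m) ≡ lab G i
  lab-↑ˡ i rewrite splitAt-↑ˡ n i m = refl

  lab-↑ʳ : ∀ j → lab T (n ↑ʳ j) ≡ lab H j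
  lab-↑ʳ j rewrite splitAt-↑ʳ n m j = refl

  private
    inL : Fin n × Fin n → Fin (n + m) × Fin (n + m)
    inL e = proj₁ e ↑ˡ m , proj₂ e ↑ˡ m

    inR : Fin m × Fin m → Fin (n + m) × Fin (n + m)
    inR e = n ↑ʳ proj₁ e , n ↑ʳ proj₂ e

    bridge : Fin (n + m) × Fin (n + m)
    bridge = u ↑ˡ m , n ↑ʳ x

    adjB-split : ∀ a b → adjB T a b ≡ any (edgeAt a b ∘ inL) (edges G) ∨ (any (edgeAt a b ∘ inR) (edges H) ∨ (edgeAt a b bridge ∨ false))
    adjB-split a b = begin
      any (edgeAt a b) (map inL (edges G) ++ map inR (edges H) ++ bridge ∷ [])
        ≡⟨ any-++ (edgeAt a b) (map inL (edges G)) _ ⟩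
      any (edgeAt a b) (map inL (edges G)) ∨ any (edgeAt a b) (map inR (edges H) ++ bridge ∷ [])
        ≡⟨ cong₂ _∨_ (any-map (edgeAt a b) inL (edges G)) (any-++ (edgeAt a b) (map inR (edges H)) _) ⟩
      any (edgeAt a b ∘ inL) (edges G) ∨ (any (edgeAt a b) (map inR (edges H)) ∨ (edgeAt a b bridge ∨ false))
        ≡⟨ cong (λ h → any (edgeAt a b ∘ inL) (edges G) ∨ (h ∨ (edgeAt a b bridge ∨ false))) (any-map (edgeAt a b) inR (edges H)) ⟩
      any (edgeAt a b ∘ inL) (edges G) ∨ (any (edgeAt a b ∘ inR) (edges H) ∨ (edgeAt a b bridge ∨ false))
        ∎
      where open ≡-Reasoning

    edgeAt-↑ˡ : ∀ i i' e → edgeAt (i ↑ˡ m) (i' ↑ˡ m) (inL e) ≡ edgeAt i i' e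
    edgeAt-↑ˡ i i' e = cong₂ _∨_ (cong₂ _∧_ (≟ˡ (proj₁ e) i) (≟ˡ (proj₂ e) i')) (cong₂ _∧_ (≟ˡ (proj₁ e) i') (≟ˡ (proj₂ e) i))
      where ≟ˡ = ≟-injective (_↑ˡ m) (↑ˡ-injective m _ _)

    edgeAt-↑ʳ : ∀ j j' e → edgeAt (n ↑ʳ j) (n ↑ʳ j') (inR e) ≡ edgeAt j j' e
    edgeAt-↑ʳ j j' e = cong₂ _∨_ (cong₂ _∧_ (≟ʳ (proj₁ e) j) (≟ʳ (proj₂ e) j')) (cong₂ _∧_ (≟ʳ (proj₁ e) j') (≟ʳ (proj₂ e) j))
      where ≟ʳ = ≟-injective (n ↑ʳ_) (↑ʳ-injective n _ _)

    ↑ʳ≢↑ˡ : ∀ j i → n ↑ʳ j ≢ i ↑ˡ m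
    ↑ʳ≢↑ˡ j i = ↑ˡ≢↑ʳ i j ∘ sym

  adjB-↑ˡ↑ˡ : ∀ i i' → adjB T (i ↑ˡ m) (i' ↑ˡ m) ≡ adjB G i i'
  adjB-↑ˡ↑ˡ i i' = trans (adjB-split _ _) (trans
    (cong₂ _∨_ (any-cong (edgeAt-↑ˡ i i') (edges G))
               (cong₂ _∨_ (any-false _ (λ e → edgeAt-avoidsˡ (↑ʳ≢↑ˡ (proj₁ e) i) (↑ʳ≢↑ˡ (proj₂ e) i)) (edges H))
                          (cong (_∨ false) (edgeAt-snd∉ {p = u ↑ˡ m} (↑ʳ≢↑ˡ x i) (↑ʳ≢↑ˡ x i')))))
    (∨-identityʳ _))

  adjB-↑ʳ↑ʳ : ∀ j j' → adjB T (n ↑ʳ j) (n ↑ʳ j') ≡ adjB H j j'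
  adjB-↑ʳ↑ʳ j j' = trans (adjB-split _ _)
    (cong₂ _∨_ (any-false _ (λ e → edgeAt-avoidsˡ (↑ˡ≢↑ʳ (proj₁ e) j) (↑ˡ≢↑ʳ (proj₂ e) j)) (edges G))
               (trans (cong₂ _∨_ (any-cong (edgeAt-↑ʳ j j') (edges H))
                                 (cong (_∨ false) (edgeAt-fst∉ {q = n ↑ʳ x} (↑ˡ≢↑ʳ u j) (↑ˡ≢↑ʳ u j'))))
                      (∨-identityʳ _)))

  adjB-↑ˡ↑ʳ : ∀ i j → adjB T (i ↑ˡ m) (n ↑ʳ j) ≡ ⌊ u ≟ i ⌋ ∧ ⌊ x ≟ j ⌋
  adjB-↑ˡ↑ʳ i j = trans (adjB-split _ _)
    (cong₂ _∨_ (any-false _ (λ e → edgeAt-avoidsʳ (↑ˡ≢↑ʳ (proj₁ e) j) (↑ˡ≢↑ʳ (proj₂ e) j)) (edges G))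
               (cong₂ _∨_ (any-false _ (λ e → edgeAt-avoidsˡ (↑ʳ≢↑ˡ (proj₁ e) i) (↑ʳ≢↑ˡ (proj₂ e) i)) (edges H))
                          (trans (∨-identityʳ _) bridge-↑ˡ↑ʳ)))
    where
    bridge-↑ˡ↑ʳ : edgeAt (i ↑ˡ m) (n ↑ʳ j) bridge ≡ ⌊ u ≟ i ⌋ ∧ ⌊ x ≟ j ⌋
    bridge-↑ˡ↑ʳ rewrite ≟-≢ (↑ˡ≢↑ʳ u j)
      = trans (∨-identityʳ _) (cong₂ _∧_ (≟-injective (_↑ˡ m) (↑ˡ-injective m _ _) u i) (≟-injective (n ↑ʳ_) (↑ʳ-injective n _ _) x j))

  adjB-↑ʳ↑ˡ : ∀ i j → adjB T (n ↑ʳ j) (i ↑ˡ m) ≡ ⌊ u ≟ i ⌋ ∧ ⌊ x ≟ j ⌋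
  adjB-↑ʳ↑ˡ i j = trans (adjB-sym T _ _) (adjB-↑ˡ↑ʳ i j)

  nbrCount-↑ˡ : ∀ i s → nbrCount T (i ↑ˡ m) s ≡ nbrCount G i s + indicator (⌊ u ≟ i ⌋ ∧ hasStatus H s x)
  nbrCount-↑ˡ i s = trans (count-↑ n _) (cong₂ _+_
    (count-cong (λ i' → cong₂ _∧_ (adjB-↑ˡ↑ˡ i i') (cong (_=S s) (lab-↑ˡ i'))))
    (trans (count-cong (λ j → cong₂ _∧_ (adjB-↑ˡ↑ʳ i j) (cong (_=S s) (lab-↑ʳ j))))
           (count-guarded ⌊ u ≟ i ⌋ x (hasStatus H s))))

  nbrCount-↑ʳ : ∀ j s → nbrCount T (n ↑ʳ j) s ≡ indicator (⌊ x ≟ j ⌋ ∧ hasStatus G s u) + nbrCount H j s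
  nbrCount-↑ʳ j s = trans (count-↑ n _) (cong₂ _+_
    (trans (count-cong (λ i → cong₂ _∧_ (trans (adjB-↑ʳ↑ˡ i j) (∧-comm ⌊ u ≟ i ⌋ ⌊ x ≟ j ⌋)) (cong (_=S s) (lab-↑ˡ i))))
           (count-guarded ⌊ x ≟ j ⌋ u (hasStatus G s)))
    (count-cong (λ j' → cong₂ _∧_ (adjB-↑ʳ↑ʳ j j') (cong (_=S s) (lab-↑ʳ j')))))

  nbrCount-↑ˡ-≥ : ∀ i s → nbrCount G i s ≤ nbrCount T (i ↑ˡ m) s
  nbrCount-↑ˡ-≥ i s = subst (nbrCount G i s ≤_) (sym (nbrCount-↑ˡ i s)) (m≤m+n _ _)

  nbrCount-↑ʳ-≥ : ∀ j s → nbrCount H j s ≤ nbrCount T (n ↑ʳ j) s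
  nbrCount-↑ʳ-≥ j s = subst (nbrCount H j s ≤_) (sym (nbrCount-↑ʳ j s)) (m≤n+m _ _)

  count-status : ∀ s → count (hasStatus T s) ≡ count (hasStatus G s) + count (hasStatus H s)
  count-status s = trans (count-↑ n _)
    (cong₂ _+_ (count-cong (cong (_=S s) ∘ lab-↑ˡ)) (count-cong (cong (_=S s) ∘ lab-↑ʳ)))

  module _ (compatible : ¬ Clash (lab G u) (lab H x)) where

    private
      bridge-unseenˡ : ∀ i c → Clash (lab G i) c → ⌊ u ≟ i ⌋ ∧ hasStatus H c x ≡ false
      bridge-unseenˡ i c i~c with u ≟ i
      ... | yes refl = clash-free compatible i~c
      ... | no  _    = refl

      bridge-unseenʳ : ∀ j c → Clash (lab H j) c → ⌊ x ≟ j ⌋ ∧ hasStatus G c u ≡ false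
      bridge-unseenʳ j c j~c with x ≟ j
      ... | yes refl = clash-free (compatible ∘ clash-sym) j~c
      ... | no  _    = refl

      bridge-B-free : ∀ i j → lab G i ≡ B → lab H j ≡ B → ⌊ u ≟ i ⌋ ∧ ⌊ x ≟ j ⌋ ≡ false
      bridge-B-free i j li lj with u ≟ i | x ≟ j
      ... | yes refl | yes refl = ⊥-elim (compatible (subst₂ Clash (sym li) (sym lj) B-B))
      ... | yes _    | no  _    = refl
      ... | no  _    | _        = refl

    profile-glue : Profile G → Profile H → Profile T
    profile-glue PG PH = record
      { B-independent = independent ; B-has-two-A = two-A ; A-has-one-B = one-B ; A-twice-B = sizes }
      where
      module PG = Profile PG
      module PH = Profile PH

      labˡ : ∀ {i s} → lab T (i ↑ˡ m) ≡ s → lab G i ≡ s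
      labˡ {i} = trans (sym (lab-↑ˡ i))

      labʳ : ∀ {j s} → lab T (n ↑ʳ j) ≡ s → lab H j ≡ s
      labʳ {j} = trans (sym (lab-↑ʳ j))

      independent : ∀ a b → lab T a ≡ B → lab T b ≡ B → adjB T a b ≡ false
      independent a b la lb with sumView n m a | sumView n m b
      ... | left i  | left i'  = trans (adjB-↑ˡ↑ˡ i i') (PG.B-independent i i' (labˡ la) (labˡ lb))
      ... | right j | right j' = trans (adjB-↑ʳ↑ʳ j j') (PH.B-independent j j' (labʳ la) (labʳ lb))
      ... | left i  | right j  = trans (adjB-↑ˡ↑ʳ i j) (bridge-B-free i j (labˡ la) (labʳ lb))
      ... | right j | left i   = trans (adjB-↑ʳ↑ˡ i j) (bridge-B-free i j (labˡ lb) (labʳ la))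

      two-A : ∀ v → lab T v ≡ B → nbrCount T v A ≡ 2
      two-A v lv with sumView n m v
      ... | left i  = trans (nbrCount-↑ˡ i A) (cong₂ _+_ (PG.B-has-two-A i (labˡ lv))
                        (cong indicator (bridge-unseenˡ i A (subst (λ s → Clash s A) (sym (labˡ lv)) B-A))))
      ... | right j = trans (nbrCount-↑ʳ j A) (cong₂ _+_
                        (cong indicator (bridge-unseenʳ j A (subst (λ s → Clash s A) (sym (labʳ lv)) B-A)))
                        (PH.B-has-two-A j (labʳ lv)))

      one-B : ∀ v → lab T v ≡ A → nbrCount T v B ≡ 1
      one-B v lv with sumView n m v
      ... | left i  = trans (nbrCount-↑ˡ i B) (cong₂ _+_ (PG.A-has-one-B i (labˡ lv))
                        (cong indicator (bridge-unseenˡ i B (subst (λ s → Clash s B) (sym (labˡ lv)) A-B))))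
      ... | right j = trans (nbrCount-↑ʳ j B) (cong₂ _+_
                        (cong indicator (bridge-unseenʳ j B (subst (λ s → Clash s B) (sym (labʳ lv)) A-B)))
                        (PH.A-has-one-B j (labʳ lv)))

      sizes : count (hasStatus T A) ≡ 2 * count (hasStatus T B)
      sizes = begin
        count (hasStatus T A)                             ≡⟨ count-status A ⟩
        count (hasStatus G A) + count (hasStatus H A)     ≡⟨ cong₂ _+_ PG.A-twice-B PH.A-twice-B ⟩
        2 * count (hasStatus G B) + 2 * count (hasStatus H B) ≡⟨ sym (*-distribˡ-+ 2 (count (hasStatus G B)) (count (hasStatus H B))) ⟩
        2 * (count (hasStatus G B) + count (hasStatus H B)) ≡⟨ cong (2 *_) (sym (count-status B)) ⟩
        2 * count (hasStatus T B)                         ∎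
        where open ≡-Reasoning

  C-has-two-B-glue : EachCHasTwoB G → (∀ j → lab H j ≡ C → 2 ≤ nbrCount T (n ↑ʳ j) B) → EachCHasTwoB T
  C-has-two-B-glue CG CH v lv with sumView n m v
  ... | left i  = ≤-trans (CG i (trans (sym (lab-↑ˡ i)) lv)) (nbrCount-↑ˡ-≥ i B)
  ... | right j = CH j (trans (sym (lab-↑ʳ j)) lv)

  private
    bridge-ends : ∀ {i j} → ⌊ u ≟ i ⌋ ∧ ⌊ x ≟ j ⌋ ≡ true → u ≡ i × x ≡ j
    bridge-ends u~x = ≟-true⇒≡ (∧-conicalˡ _ _ u~x) , ≟-true⇒≡ (∧-conicalʳ _ _ u~x)

  onG : (Fin (n + m) → Bool) → Fin n → Bool
  onG d = d ∘ (_↑ˡ m)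

  onH : (Fin (n + m) → Bool) → Fin m → Bool
  onH d = d ∘ (n ↑ʳ_)

  dominated-↑ˡ : ∀ {d} i → Dominated T d (i ↑ˡ m) → Dominated G (onG d) i ⊎ (u ≡ i × d (n ↑ʳ x) ≡ true)
  dominated-↑ˡ i (inj₁ di) = inj₁ (inj₁ di)
  dominated-↑ˡ i (inj₂ (w , dw , w~i)) with sumView n m w
  ... | left i' = inj₁ (inj₂ (i' , dw , trans (sym (adjB-↑ˡ↑ˡ i' i)) w~i))
  ... | right j with bridge-ends (trans (sym (adjB-↑ʳ↑ˡ i j)) w~i)
  ...   | refl , refl = inj₂ (refl , dw)

  dominated-↑ʳ : ∀ {d} j → Dominated T d (n ↑ʳ j) → Dominated H (onH d) j ⊎ (x ≡ j × d (u ↑ˡ m) ≡ true)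
  dominated-↑ʳ j (inj₁ dj) = inj₁ (inj₁ dj)
  dominated-↑ʳ j (inj₂ (w , dw , w~j)) with sumView n m w
  ... | right j' = inj₁ (inj₂ (j' , dw , trans (sym (adjB-↑ʳ↑ʳ j' j)) w~j))
  ... | left i with bridge-ends (trans (sym (adjB-↑ˡ↑ʳ i j)) w~j)
  ...   | refl , refl = inj₂ (refl , dw)

  module _ {d : Fin (n + m) → Bool} (dom : DominatesNonC T d) where

    restrictˡ : (e : Fin n → Bool) → (∀ i → d (i ↑ˡ m) ≡ true → e i ≡ true)
      → (lab G u ≢ C → d (n ↑ʳ x) ≡ true → e u ≡ true) → DominatesNonC G e
    restrictˡ e d⊆e bridged i i≢C with dominated-↑ˡ i (dom (i ↑ˡ m) (i≢C ∘ trans (sym (lab-↑ˡ i))))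
    ... | inj₁ dominatedG = dominated-mono G d⊆e dominatedG
    ... | inj₂ (refl , dx) = inj₁ (bridged i≢C dx)

    restrictʳ : (e : Fin m → Bool) → (∀ j → d (n ↑ʳ j) ≡ true → e j ≡ true)
      → (lab H x ≢ C → d (u ↑ˡ m) ≡ true → e x ≡ true) → DominatesNonC H e
    restrictʳ e d⊆e bridged j j≢C with dominated-↑ʳ j (dom (n ↑ʳ j) (j≢C ∘ trans (sym (lab-↑ʳ j))))
    ... | inj₁ dominatedH = dominated-mono H d⊆e dominatedH
    ... | inj₂ (refl , du) = inj₁ (bridged j≢C du)

  module _ (d : Fin (n + m) → Bool) where

    <-glueˡ : count (hasStatus G B) < count (onG d) → count (hasStatus H B) ≤ count (onH d) → count (hasStatus T B) < count d
    <-glueˡ G< H≤ rewrite count-status B | count-↑ n d = +-mono-<-≤ G< H≤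

    <-glueʳ : count (hasStatus G B) ≤ count (onG d) → count (hasStatus H B) < count (onH d) → count (hasStatus T B) < count d
    <-glueʳ G≤ H< rewrite count-status B | count-↑ n d = +-mono-≤-< G≤ H<

    unique-minimum-combine : count (hasStatus G B) < count (onG d) ⊎ onG d ≗ hasStatus G B
      → count (hasStatus H B) < count (onH d) ⊎ onH d ≗ hasStatus H B
      → count (hasStatus T B) < count d ⊎ d ≗ hasStatus T B
    unique-minimum-combine (inj₁ G<) (inj₁ H<) = inj₁ (<-glueˡ G< (<⇒≤ H<))
    unique-minimum-combine (inj₁ G<) (inj₂ H≗) = inj₁ (<-glueˡ G< (≤-reflexive (count-cong (sym ∘ H≗))))
    unique-minimum-combine (inj₂ G≗) (inj₁ H<) = inj₁ (<-glueʳ (≤-reflexive (count-cong (sym ∘ G≗))) H<)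
    unique-minimum-combine (inj₂ G≗) (inj₂ H≗) = inj₂ d≗B
      where
      d≗B : d ≗ hasStatus T B
      d≗B k with sumView n m k
      ... | left i  = trans (G≗ i) (cong (_=S B) (sym (lab-↑ˡ i)))
      ... | right j = trans (H≗ j) (cong (_=S B) (sym (lab-↑ʳ j)))

  unique-minimum-glue : UniqueMinimum G → UniqueMinimum H → lab G u ≢ B → lab H x ≢ B → UniqueMinimum T
  unique-minimum-glue uG uH u≢B x≢B d dom with d (u ↑ˡ m) in du | d (n ↑ʳ x) in dx
  ... | false | false = unique-minimum-combine d
          (uG (onG d) (restrictˡ dom (onG d) (λ _ di → di) (λ _ dx′ → bool-clash dx′ dx)))
          (uH (onH d) (restrictʳ dom (onH d) (λ _ dj → dj) (λ _ du′ → bool-clash du′ du)))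
  ... | true | _ = inj₁ (<-glueˡ d
          (unique-minimum-< {G} uG (onG d) u≢B du (restrictˡ dom (onG d) (λ _ di → di) (λ _ _ → du)))
          (unique-minimum-insert {H} uH (onH d) x≢B
            (restrictʳ dom (insert x (onH d)) (insert-⊇ x (onH d)) (λ _ _ → insert-new x (onH d)))))
  ... | false | true = inj₁ (<-glueʳ d
          (unique-minimum-insert {G} uG (onG d) u≢B
            (restrictˡ dom (insert u (onG d)) (insert-⊇ u (onG d)) (λ _ _ → insert-new u (onG d))))
          (unique-minimum-< {H} uH (onH d) x≢B dx (restrictʳ dom (onH d) (λ _ dj → dj) (λ _ _ → dx))))

  unique-minimum-glue-C : UniqueMinimum G → lab G u ≡ C → UniqueMinimum H
    → (∀ e → (∀ j → lab H j ≢ C → j ≢ x → Dominated H e j) → e x ≡ false → count (hasStatus H B) < count e)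
    → UniqueMinimum T
  unique-minimum-glue-C uG uC uH x-needed d dom with d (n ↑ʳ x) in dx
  ... | false = inj₁ (<-glueʳ d (unique-minimum-≤ {G} uG (onG d) domG) (x-needed (onH d) dominates-H∖x dx))
    where
    domG : DominatesNonC G (onG d)
    domG = restrictˡ dom (onG d) (λ _ di → di) (λ u≢C _ → ⊥-elim (u≢C uC))
    dominates-H∖x : ∀ j → lab H j ≢ C → j ≢ x → Dominated H (onH d) j
    dominates-H∖x j j≢C j≢x with dominated-↑ʳ j (dom (n ↑ʳ j) (j≢C ∘ trans (sym (lab-↑ʳ j))))
    ... | inj₁ dominatedH = dominatedH
    ... | inj₂ (refl , _) = ⊥-elim (j≢x refl)
  ... | true = unique-minimum-combine d
          (uG (onG d) (restrictˡ dom (onG d) (λ _ di → di) (λ u≢C _ → ⊥-elim (u≢C uC))))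
          (uH (onH d) (restrictʳ dom (onH d) (λ _ dj → dj) (λ _ _ → dx)))

  module _ (PG : Profile G) (uB : lab G u ≡ B) where

    private
      -- An A-neighbour of u has u as its only B-neighbour and no neighbour outside G.
      B-vertex-needed : ∀ {d} → DominatesNonC T d → d (u ↑ˡ m) ≡ false → ¬ insert u (onG d) ≗ hasStatus G B
      B-vertex-needed {d} dom du d+u≗B with A-neighbour PG uB
      ... | a , u~a , la with dominated-↑ˡ a (dom (a ↑ˡ m) (λ aC → A≢C (trans (sym la) (trans (sym (lab-↑ˡ a)) aC))))
      ...   | inj₁ dominatedG = A-neighbour-needs-B PG uB u~a la (onG d) du
                (λ i di → =S⇒≡ (trans (sym (d+u≗B i)) (insert-⊇ u (onG d) i di))) dominatedG
      ...   | inj₂ (refl , _) with () ← trans (sym la) uB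

    onG-≥-B : UniqueMinimum G → ∀ {d} → DominatesNonC T d → count (hasStatus G B) ≤ count (onG d)
    onG-≥-B uG {d} dom with d (u ↑ˡ m) in du
    ... | true  = unique-minimum-≤ {G} uG (onG d) (restrictˡ dom (onG d) (λ _ di → di) (λ _ _ → du))
    ... | false with uG (insert u (onG d)) (restrictˡ dom (insert u (onG d)) (insert-⊇ u (onG d)) (λ _ _ → insert-new u (onG d)))
    ...   | inj₁ B<d+u = ≤-pred (≤-trans B<d+u (count-insert u (onG d)))
    ...   | inj₂ d+u≗B = ⊥-elim (B-vertex-needed dom du d+u≗B)

    unique-minimum-glue-B : UniqueMinimum G → lab H x ≡ C → UniqueMinimum H → UniqueMinimum T
    unique-minimum-glue-B uG xC uH d dom with d (n ↑ʳ x) in dx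
    ... | false = unique-minimum-combine d
            (uG (onG d) (restrictˡ dom (onG d) (λ _ di → di) (λ _ dx′ → bool-clash dx′ dx)))
            (uH (onH d) (restrictʳ dom (onH d) (λ _ dj → dj) (λ x≢C _ → ⊥-elim (x≢C xC))))
    ... | true  = inj₁ (<-glueʳ d (onG-≥-B uG dom)
            (unique-minimum-< {H} uH (onH d) (λ xB → C≢B (trans (sym xC) xB)) dx (restrictʳ dom (onH d) (λ _ dj → dj) (λ _ _ → dx))))

record Invariants (G : LGraph) : Set where
  field
    profile        : Profile G
    C-has-two-B   : EachCHasTwoB G
    unique-minimum : UniqueMinimum G

clash-needs-B : ∀ {s t} → Clash s t → s ≡ B ⊎ t ≡ B
clash-needs-B B-B = inj₁ refl
clash-needs-B B-A = inj₁ refl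
clash-needs-B A-B = inj₂ refl

module _ {G H : LGraph} {u : Fin (size G)} {x : Fin (size H)} where
  open Glued G H u x

  invariants-glue : Invariants G → Invariants H → lab G u ≢ B → lab H x ≢ B → Invariants T
  invariants-glue IG IH u≢B x≢B = record
    { profile        = profile-glue no-clash (profile IG) (profile IH)
    ; C-has-two-B   = C-has-two-B-glue (C-has-two-B IG) (λ j jC → ≤-trans (C-has-two-B IH j jC) (nbrCount-↑ʳ-≥ j B))
    ; unique-minimum = unique-minimum-glue (unique-minimum IG) (unique-minimum IH) u≢B x≢B
    }
    where
    open Invariants
    no-clash : ¬ Clash (lab G u) (lab H x)
    no-clash u~x with clash-needs-B u~x
    ... | inj₁ uB = u≢B uB
    ... | inj₂ xB = x≢B xB

pattern f0 = zero
pattern f1 = suc zero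
pattern f2 = suc (suc zero)
pattern f3 = suc (suc (suc zero))

leaf-dominated : ∀ G {d v c} → (∀ w → adjB G w v ≡ true → w ≡ c) → d c ≡ false → Dominated G d v → d v ≡ true
leaf-dominated G leaf dc (inj₁ dv) = dv
leaf-dominated G leaf dc (inj₂ (w , dw , w~v)) with refl ← leaf w w~v = bool-clash dw dc

P3-leaf₀ : ∀ w → adjB P3 w f0 ≡ true → w ≡ f1
P3-leaf₀ f1 _ = refl

P3-leaf₂ : ∀ w → adjB P3 w f2 ≡ true → w ≡ f1
P3-leaf₂ f1 _ = refl

invariants-P3 : Invariants P3
invariants-P3 = record
  { profile = record
    { B-independent = λ { f1 f1 _ _ → refl ; f0 _ () _ ; f2 _ () _ ; f1 f0 _ () ; f1 f2 _ () }
    ; B-has-two-A   = λ { f1 _ → refl ; f0 () ; f2 () }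
    ; A-has-one-B   = λ { f0 _ → refl ; f2 _ → refl ; f1 () }
    ; A-twice-B     = refl
    }
  ; C-has-two-B   = λ { f0 () ; f1 () ; f2 () }
  ; unique-minimum = unique
  }
  where
  unique : UniqueMinimum P3
  unique d dom = by-cases (d f0) (d f1) (d f2) refl refl refl
    where
    by-cases : ∀ b0 b1 b2 → d f0 ≡ b0 → d f1 ≡ b1 → d f2 ≡ b2 → count (hasStatus P3 B) < count d ⊎ d ≗ hasStatus P3 B
    by-cases true  true  _     d0 d1 d2 = inj₁ (count-≥2 d f0 f1 (λ ()) d0 d1)
    by-cases _     true  true  d0 d1 d2 = inj₁ (count-≥2 d f1 f2 (λ ()) d1 d2)
    by-cases false true  false d0 d1 d2 = inj₂ λ { f0 → d0 ; f1 → d1 ; f2 → d2 }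
    by-cases _     false _     d0 d1 d2 = inj₁ (count-≥2 d f0 f2 (λ ())
                                            (leaf-dominated P3 P3-leaf₀ d1 (dom f0 (λ ())))
                                            (leaf-dominated P3 P3-leaf₂ d1 (dom f2 (λ ()))))

P3-centre-needed : ∀ e → (∀ j → lab P3 j ≢ C → j ≢ f1 → Dominated P3 e j) → e f1 ≡ false
  → count (hasStatus P3 B) < count e
P3-centre-needed e dom e1 = count-≥2 e f0 f2 (λ ())
  (leaf-dominated P3 P3-leaf₀ e1 (dom f0 (λ ()) (λ ())))
  (leaf-dominated P3 P3-leaf₂ e1 (dom f2 (λ ()) (λ ())))

Star-leaf₂ : ∀ w → adjB Star w f2 ≡ true → w ≡ f1
Star-leaf₂ f1 _ = refl

Star-leaf₃ : ∀ w → adjB Star w f3 ≡ true → w ≡ f1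
Star-leaf₃ f1 _ = refl

profile-Star : Profile Star
profile-Star = record
  { B-independent = λ { f1 f1 _ _ → refl ; f0 _ () _ ; f2 _ () _ ; f3 _ () _ ; f1 f0 _ () ; f1 f2 _ () ; f1 f3 _ () }
  ; B-has-two-A   = λ { f1 _ → refl ; f0 () ; f2 () ; f3 () }
  ; A-has-one-B   = λ { f2 _ → refl ; f3 _ → refl ; f0 () ; f1 () }
  ; A-twice-B     = refl
  }

unique-minimum-Star : UniqueMinimum Star
unique-minimum-Star d dom = by-cases (d f0) (d f1) (d f2) (d f3) refl refl refl refl
  where
  by-cases : ∀ b0 b1 b2 b3 → d f0 ≡ b0 → d f1 ≡ b1 → d f2 ≡ b2 → d f3 ≡ b3
    → count (hasStatus Star B) < count d ⊎ d ≗ hasStatus Star B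
  by-cases true  true  _     _     d0 d1 d2 d3 = inj₁ (count-≥2 d f0 f1 (λ ()) d0 d1)
  by-cases _     true  true  _     d0 d1 d2 d3 = inj₁ (count-≥2 d f1 f2 (λ ()) d1 d2)
  by-cases _     true  _     true  d0 d1 d2 d3 = inj₁ (count-≥2 d f1 f3 (λ ()) d1 d3)
  by-cases false true  false false d0 d1 d2 d3 = inj₂ λ { f0 → d0 ; f1 → d1 ; f2 → d2 ; f3 → d3 }
  by-cases _     false _     _     d0 d1 d2 d3 = inj₁ (count-≥2 d f2 f3 (λ ())
                                                 (leaf-dominated Star Star-leaf₂ d1 (dom f2 (λ ())))
                                                 (leaf-dominated Star Star-leaf₃ d1 (dom f3 (λ ()))))

module _ {G : LGraph} {u : Fin (size G)} (IG : Invariants G) where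
  open Invariants

  invariants-glue-Star : lab G u ≡ B → Invariants (glue G Star u f0)
  invariants-glue-Star uB = record
    { profile        = profile-glue (λ ()) (profile IG) profile-Star
    ; C-has-two-B   = C-has-two-B-glue (C-has-two-B IG) C-in-Star
    ; unique-minimum = unique-minimum-glue-B (profile IG) uB (unique-minimum IG) refl unique-minimum-Star
    }
    where
    open Glued G Star u f0
    C-in-Star : ∀ j → lab Star j ≡ C → 2 ≤ nbrCount T (n ↑ʳ j) B
    C-in-Star f0 _ rewrite nbrCount-↑ʳ f0 B | uB = s≤s (s≤s z≤n)
    C-in-Star f1 ()
    C-in-Star f2 ()
    C-in-Star f3 ()

  invariants-glue-P3-centre : lab G u ≡ C → Invariants (glue G P3 u f1)
  invariants-glue-P3-centre uC = record
    { profile        = profile-glue no-clash (profile IG) (profile invariants-P3)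
    ; C-has-two-B   = C-has-two-B-glue (C-has-two-B IG) (λ { f0 () ; f1 () ; f2 () })
    ; unique-minimum = unique-minimum-glue-C (unique-minimum IG) uC (unique-minimum invariants-P3) P3-centre-needed
    }
    where
    open Glued G P3 u f1
    no-clash : ¬ Clash (lab G u) B
    no-clash rewrite uC = λ ()

invariants-R : Invariants R
invariants-R = invariants-glue-Star invariants-P3 refl

invariants : ∀ {G} → InFamily G → Invariants G
invariants base         = invariants-P3
invariants (O1 G∈ u uAC) = invariants-glue (invariants G∈) invariants-P3 (A-or-C⇒≢B uAC) (λ ())
invariants (O2 G∈ u uB)  = invariants-glue-Star (invariants G∈) uB
invariants (O3 G∈ u uC)  = invariants-glue-P3-centre (invariants G∈) uC
invariants (O4 G∈ u uAC) = invariants-glue (invariants G∈) invariants-R (A-or-C⇒≢B uAC) (λ ())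

∈-tabulate⁻ : ∀ {n} (f : Fin n → Bool) {i} → i ∈ tabulate f → f i ≡ true
∈-tabulate⁻ f {i} i∈ = trans (sym (lookup∘tabulate f i)) ([]=⇒lookup i∈)

∈-tabulate⁺ : ∀ {n} (f : Fin n → Bool) {i} → f i ≡ true → i ∈ tabulate f
∈-tabulate⁺ f {i} fi = lookup⇒[]= i (tabulate f) (trans (lookup∘tabulate f i) fi)

∣tabulate∣ : ∀ {n} (f : Fin n → Bool) → ∣ tabulate f ∣ ≡ count f
∣tabulate∣ {zero}  f = refl
∣tabulate∣ {suc n} f with f zero
... | true  = cong suc (∣tabulate∣ (f ∘ suc))
... | false = ∣tabulate∣ (f ∘ suc)

∣∣≡count-lookup : ∀ {n} (p : Subset n) → ∣ p ∣ ≡ count (lookup p)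
∣∣≡count-lookup p = trans (cong ∣_∣ (sym (tabulate∘lookup p))) (∣tabulate∣ (lookup p))

lookup-⁅⁆ : ∀ {n} (v w : Fin n) → lookup ⁅ v ⁆ w ≡ ⌊ v ≟ w ⌋
lookup-⁅⁆ zero    zero    = refl
lookup-⁅⁆ zero    (suc w) = lookup-replicate w false
lookup-⁅⁆ (suc v) zero    = refl
lookup-⁅⁆ (suc v) (suc w) = trans (lookup-⁅⁆ v w) (sym (⌊⌋-map′ (cong suc) suc-injective (v ≟ w)))

subset-≗ : ∀ {n} {p : Subset n} {f : Fin n → Bool} → (∀ i → lookup p i ≡ f i) → p ≡ tabulate f
subset-≗ {p = p} p≗f = trans (sym (tabulate∘lookup p)) (tabulate-cong p≗f)

lookup-∩ : ∀ {n} (p q : Subset n) i → lookup (p ∩ q) i ≡ lookup p i ∧ lookup q i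
lookup-∩ p q i = lookup-zipWith _∧_ i p q

lookup-∪ : ∀ {n} (p q : Subset n) i → lookup (p ∪ q) i ≡ lookup p i ∨ lookup q i
lookup-∪ p q i = lookup-zipWith _∨_ i p q

module _ {G : LGraph} (I : Invariants G) where
  open Invariants I
  open Profile profile

  private
    SA SB : Subset (size G)
    SA = statusSet G A
    SB = statusSet G B

  N∩statusSet : ∀ v s → N G v ∩ statusSet G s ≡ tabulate (λ w → adjB G v w ∧ hasStatus G s w)
  N∩statusSet v s = subset-≗ λ w →
    trans (lookup-∩ (N G v) (statusSet G s) w) (cong₂ _∧_ (lookup∘tabulate _ w) (lookup∘tabulate _ w))

  ∣N∩statusSet∣ : ∀ v s → ∣ N G v ∩ statusSet G s ∣ ≡ nbrCount G v s
  ∣N∩statusSet∣ v s = trans (cong ∣_∣ (N∩statusSet v s)) (∣tabulate∣ (λ w → adjB G v w ∧ hasStatus G s w))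

  SB-independent : Independent G SB
  SB-independent u v u∈ v∈ v∈Nu = bool-clash (∈-tabulate⁻ (adjB G u) v∈Nu)
    (B-independent u v (=S⇒≡ (∈-tabulate⁻ (hasStatus G B) u∈)) (=S⇒≡ (∈-tabulate⁻ (hasStatus G B) v∈)))

  private
    B-neighbour : ∀ v → 1 ≤ nbrCount G v B → Σ (Fin (size G)) λ u → u ∈ SB × v ∈ N G u
    B-neighbour v 1≤ with count-witness (λ w → adjB G v w ∧ hasStatus G B w) 1≤
    ... | u , v~u∧uB = u , ∈-tabulate⁺ (hasStatus G B) (∧-conicalʳ _ _ v~u∧uB)
                         , ∈-tabulate⁺ (adjB G u) (trans (adjB-sym G u v) (∧-conicalˡ _ _ v~u∧uB))

  SB-dominating : Dominating G SB
  SB-dominating v with lab G v in lv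
  ... | A = inj₂ (B-neighbour v (≤-reflexive (sym (A-has-one-B v lv))))
  ... | B = inj₁ (∈-tabulate⁺ (hasStatus G B) (≡⇒=S lv))
  ... | C = inj₂ (B-neighbour v (≤-trans (s≤s z≤n) (C-has-two-B v lv)))

  dominating⇒non-C : ∀ D → Dominating G D → DominatesNonC G (lookup D)
  dominating⇒non-C D dom v _ with dom v
  ... | inj₁ v∈D              = inj₁ ([]=⇒lookup v∈D)
  ... | inj₂ (u , u∈D , v∈Nu) = inj₂ (u , []=⇒lookup u∈D , ∈-tabulate⁻ (adjB G u) v∈Nu)

  SB-unique-γ-set : UniqueGammaSet G SB
  SB-unique-γ-set = (SB-dominating , minimum) , only
    where
    ∣SB∣ = ∣tabulate∣ (hasStatus G B)

    minimum : ∀ D → Dominating G D → ∣ SB ∣ ≤ ∣ D ∣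
    minimum D dom = subst₂ _≤_ (sym ∣SB∣) (sym (∣∣≡count-lookup D))
      (unique-minimum-≤ {G} unique-minimum (lookup D) (dominating⇒non-C D dom))

    only : ∀ D → IsGammaSet G D → D ≡ SB
    only D (dom , min) with unique-minimum (lookup D) (dominating⇒non-C D dom)
    ... | inj₁ B<D = ⊥-elim (<-irrefl refl (<-≤-trans B<D (subst₂ _≤_ (∣∣≡count-lookup D) ∣SB∣ (min SB SB-dominating))))
    ... | inj₂ D≗B = subset-≗ D≗B

  module _ {v : Fin (size G)} (vB : lab G v ≡ B) where

    private
      closed-B : Fin (size G) → Fin (size G) → Bool
      closed-B y w = (adjB G y w ∨ ⌊ y ≟ w ⌋) ∧ hasStatus G B w

      private-to-v : Fin (size G) → Bool
      private-to-v y = (adjB G v y ∧ hasStatus G A y) ∨ ⌊ v ≟ y ⌋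

      closed-B-self : ∀ y → closed-B y y ≡ hasStatus G B y
      closed-B-self y rewrite ≟-refl y | ∨-zeroʳ (adjB G y y) = refl

      closed-B-other : ∀ {y w} → y ≢ w → closed-B y w ≡ adjB G y w ∧ hasStatus G B w
      closed-B-other {y} {w} y≢w rewrite ≟-≢ y≢w | ∨-identityʳ (adjB G y w) = refl

      closed-B-at-v : ∀ w → closed-B v w ≡ ⌊ v ≟ w ⌋
      closed-B-at-v w with ≡-or-≢ v w
      ... | inj₁ refl = trans (closed-B-self v) (trans (≡⇒=S vB) (sym (≟-refl v)))
      ... | inj₂ v≢w  = trans (closed-B-other v≢w) (trans (B-no-B-neighbour profile w vB) (sym (≟-≢ v≢w)))

      closed-B-at-A : ∀ {y} → lab G y ≡ A → adjB G y v ≡ true → ∀ w → closed-B y w ≡ ⌊ v ≟ w ⌋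
      closed-B-at-A {y} yA y~v w with ≡-or-≢ v w | ≡-or-≢ y w
      ... | inj₁ refl | inj₁ refl with () ← trans (sym yA) vB
      ... | inj₁ refl | inj₂ y≢v  = trans (closed-B-other y≢v) (trans (cong₂ _∧_ y~v (≡⇒=S vB)) (sym (≟-refl v)))
      ... | inj₂ v≢y  | inj₁ refl = trans (closed-B-self y) (trans (≢⇒=S-false (λ yB → A≢B (trans (sym yA) yB))) (sym (≟-≢ v≢y)))
      ... | inj₂ v≢w  | inj₂ y≢w  = trans (closed-B-other y≢w) (trans (A-one-B-neighbour profile w yA y~v vB (v≢w ∘ sym)) (sym (≟-≢ v≢w)))

      private⇒closed-B : ∀ y → private-to-v y ≡ true → ∀ w → closed-B y w ≡ ⌊ v ≟ w ⌋
      private⇒closed-B y py with ≡-or-≢ v y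
      ... | inj₁ refl = closed-B-at-v
      ... | inj₂ v≢y  = closed-B-at-A (=S⇒≡ (∧-conicalʳ _ _ v~y∧yA)) (trans (adjB-sym G y v) (∧-conicalˡ _ _ v~y∧yA))
        where
        v~y∧yA : adjB G v y ∧ hasStatus G A y ≡ true
        v~y∧yA = trans (sym (∨-identityʳ _)) (trans (cong ((adjB G v y ∧ hasStatus G A y) ∨_) (sym (≟-≢ v≢y))) py)

      private-has-one-B-neighbour : ∀ {y} → (∀ w → closed-B y w ≡ ⌊ v ≟ w ⌋) → nbrCount G y B ≤ 1
      private-has-one-B-neighbour {y} N[y]∩B≗v =
        ≤-trans (count-mono (λ w → adjB G y w ∧ hasStatus G B w) (λ w → ⌊ v ≟ w ⌋) B-nbr⇒v) (≤-reflexive (count-singleton v))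
        where
        B-nbr⇒v : ∀ w → adjB G y w ∧ hasStatus G B w ≡ true → ⌊ v ≟ w ⌋ ≡ true
        B-nbr⇒v w y~w∧wB = trans (sym (N[y]∩B≗v w))
          (cong₂ _∧_ (cong (_∨ ⌊ y ≟ w ⌋) (∧-conicalˡ (adjB G y w) _ y~w∧wB)) (∧-conicalʳ (adjB G y w) _ y~w∧wB))

      closed-B⇒adjacent : ∀ {y} → v ≢ y → (∀ w → closed-B y w ≡ ⌊ v ≟ w ⌋) → adjB G y v ≡ true
      closed-B⇒adjacent v≢y N[y]∩B≗v =
        ∧-conicalˡ _ _ (trans (sym (closed-B-other (v≢y ∘ sym))) (trans (N[y]∩B≗v v) (≟-refl v)))

      closed-B⇒private : ∀ y → (∀ w → closed-B y w ≡ ⌊ v ≟ w ⌋) → private-to-v y ≡ true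
      closed-B⇒private y N[y]∩B≗v with ≡-or-≢ v y
      ... | inj₁ refl rewrite ≟-refl v = ∨-zeroʳ _
      ... | inj₂ v≢y with lab G y in yS
      ...   | A rewrite ≟-≢ v≢y | adjB-sym G v y | closed-B⇒adjacent v≢y N[y]∩B≗v = refl
      ...   | B = bool-clash (trans (closed-B-self y) (≡⇒=S yS)) (trans (N[y]∩B≗v y) (≟-≢ v≢y))
      ...   | C with s≤s () ← ≤-trans (C-has-two-B y yS) (private-has-one-B-neighbour N[y]∩B≗v)

    pn-SB : pn G v SB ≡ (N G v ∩ SA) ∪ ⁅ v ⁆
    pn-SB = trans (tabulate-cong is-private) (sym (subset-≗ lookup-rhs))
      where
      lookup-rhs : ∀ y → lookup ((N G v ∩ SA) ∪ ⁅ v ⁆) y ≡ private-to-v y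
      lookup-rhs y = trans (lookup-∪ (N G v ∩ SA) ⁅ v ⁆ y) (cong₂ _∨_
        (trans (lookup-∩ (N G v) SA y) (cong₂ _∧_ (lookup∘tabulate (adjB G v) y) (lookup∘tabulate (hasStatus G A) y)))
        (lookup-⁅⁆ v y))

      lookup-N[]∩SB : ∀ y w → lookup (N[ G ] y ∩ SB) w ≡ closed-B y w
      lookup-N[]∩SB y w = trans (lookup-∩ (N[ G ] y) SB w) (cong₂ _∧_
        (trans (lookup-∪ (N G y) ⁅ y ⁆ w) (cong₂ _∨_ (lookup∘tabulate (adjB G y) w) (lookup-⁅⁆ y w)))
        (lookup∘tabulate (hasStatus G B) w))

      is-private : ∀ y → ⌊ ≡-dec 𝔹._≟_ (N[ G ] y ∩ SB) ⁅ v ⁆ ⌋ ≡ private-to-v y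
      is-private y with ≡-dec 𝔹._≟_ (N[ G ] y ∩ SB) ⁅ v ⁆
      ... | yes N[y]∩B≡v = sym (closed-B⇒private y λ w →
              trans (sym (lookup-N[]∩SB y w)) (trans (cong (λ V → lookup V w) N[y]∩B≡v) (lookup-⁅⁆ v w)))
      ... | no  N[y]∩B≢v with private-to-v y in py
      ...   | false = refl
      ...   | true  = ⊥-elim (N[y]∩B≢v (trans (subset-≗ λ w → trans (lookup-N[]∩SB y w) (private⇒closed-B y py w))
                                              (sym (subset-≗ (lookup-⁅⁆ v)))))

∈-statusSet⁻ : ∀ G {s v} → v ∈ statusSet G s → lab G v ≡ s
∈-statusSet⁻ G {s} = =S⇒≡ ∘ ∈-tabulate⁻ (hasStatus G s)

mainTheorem7 : (G : LGraph) → InFamily G →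
    (Independent G (statusSet G B) × Dominating G (statusSet G B)
      × (∀ v → v ∈ statusSet G B → ∣ N G v ∩ statusSet G A ∣ ≡ 2)
      × (∀ v → v ∈ statusSet G B → pn G v (statusSet G B) ≡ (N G v ∩ statusSet G A) ∪ ⁅ v ⁆))
    × ((∀ v → v ∈ statusSet G A → ∣ N G v ∩ statusSet G B ∣ ≡ 1)
      × ∣ statusSet G A ∣ ≡ 2 * ∣ statusSet G B ∣)
    × (∀ v → v ∈ statusSet G C → 2 ≤ ∣ N G v ∩ statusSet G B ∣)
    × UniqueGammaSet G (statusSet G B)
mainTheorem7 G G∈𝒯 =
  ( SB-independent I , SB-dominating I
  , (λ v v∈B → trans (∣N∩statusSet∣ I v A) (B-has-two-A v (∈-statusSet⁻ G v∈B)))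
  , (λ v v∈B → pn-SB I (∈-statusSet⁻ G v∈B)) )
  , ( (λ v v∈A → trans (∣N∩statusSet∣ I v B) (A-has-one-B v (∈-statusSet⁻ G v∈A)))
    , trans (∣tabulate∣ (hasStatus G A)) (trans A-twice-B (cong (2 *_) (sym (∣tabulate∣ (hasStatus G B))))) )
  , (λ v v∈C → subst (2 ≤_) (sym (∣N∩statusSet∣ I v B)) (C-has-two-B v (∈-statusSet⁻ G v∈C)))
  , SB-unique-γ-set I
  where
  I = invariants G∈𝒯
  open Invariants I
  open Profile profile
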